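{- Let $a_3=3$, $a_5=15$, $a_7=21$, $a_9=15$, $a_{11}=33$, $a_{13}=1365$, $a_{15}=3$. Then for every $r\in\{2,3,4,5,6,7,8\}$ and every positive integer $n$, $$a_{2r-1}\sum_{k=0}^{n-1}S_k^{(2r-1)}\equiv 0\pmod{n^2},$$ where $S_m^{(s)}=\sum_{k=0}^{m}\binom{m}{k}^2\binom{2k}{k}(2k+1)^{s}$. -}

module Defs where

open import Data.Nat using (ℕ; zero; suc; _+_; _*_; _^_)
open import Data.Nat.Combinatorics using (_C_)

sumTo : ℕ → (ℕ → ℕ) → ℕ
sumTo zero    f = f 0
sumTo (suc m) f = sumTo m f + f (suc m)

sumBelow : ℕ → (ℕ → ℕ) → ℕ
sumBelow zero    f = 0
sumBelow (suc n) f = sumBelow n f + f n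

S : ℕ → ℕ → ℕ
S s m = sumTo m (λ k → (m C k) ^ 2 * ((2 * k) C k) * (2 * k + 1) ^ s)

a : ℕ → ℕ
a 3  = 3
a 5  = 15
a 7  = 21
a 9  = 15
a 11 = 33
a 13 = 1365
a 15 = 3
a _  = 0

-- Wilf–Zeilberger telescoping. Put T(m,k) = C(m,k)² C(2k,k), ω(k) = (2k+1)^s and
-- R(m,k) = C(m−1,k)² Cat(k) P(m,k), with Cat(k) the Catalan number and P, Q the computer-found
-- polynomials listed at the end. Then F(m,k) = a T(m,k) ω(k) − (m+1)² R(m+1,k) + m² R(m,k) and
-- G(m,k) = k³ T(m+1,k) Q(m,k) satisfy c (m+1)² (F(m,k) − F(m+1,k)) = G(m,k+1) − G(m,k); after dividing
-- out the hypergeometric term T this is a polynomial identity, checked by ring normalisation.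
-- Summed over k the G-terms cancel, so Σₖ F(m,k) does not depend on m and vanishes as for m = 0;
-- that is, a S_m + m² V_m = (m+1)² V_{m+1} with V_m = Σₖ R(m,k) ∈ ℤ, and summing over m gives
-- a Σ_{m<n} S_m = n² V_n.

module Submission where

open import Defs

module WZ-Method where
  open import Data.Integer.Base using (ℤ; +_; -_; _+_; _-_; _*_; 0ℤ; 1ℤ; ∣_∣; NonZero)
  open import Data.Integer.Properties
    using (pos-+; pos-*; +-comm; +-identityʳ; +-inverseʳ; *-assoc; *-comm; *-distribˡ-+; *-cancelˡ-≡; *-zeroʳ; i-j≡0⇒i≡j; abs-*)
  open import Data.Integer.Tactic.RingSolver using (ring; solve; solve-∀)
  open import Data.List.Base using (List; []; _∷_)
  open import Data.Product.Base using (_×_; _,_)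
  open import Data.Nat.Base as ℕ using (ℕ; zero; suc)
  open import Data.Nat.Combinatorics using (_C_; nCk+nC[k+1]≡[n+1]C[k+1]; nC1≡n)
  open import Data.Nat.Combinatorics.Specification using (k>n⇒nCk≡0)
  import Data.Nat.Properties as ℕ
  import Data.Nat.Divisibility as ℕ
  import Data.Nat.Tactic.RingSolver as ℕ-Solver
  open import Relation.Binary.PropositionalEquality using (_≡_; refl; sym; trans; cong; cong₂; module ≡-Reasoning)
  open import Tactic.RingSolver.Core.AlmostCommutativeRing using (module AlmostCommutativeRing)
  open import Tactic.RingSolver.Core.Expression using (Expr; Κ; Ι; _⊕_; _⊗_; _⊛_; ⊝_)
  open import Tactic.RingSolver.NonReflective ring using (module Ops)
  open import Data.Vec.Base as Vec using (Vec)
  open import Data.Vec.Properties using (lookup-map)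
  import Data.Fin.Base as Fin

  -- The solver's own power (not Data.Integer's _^_), so that `solve` sees through it.
  open AlmostCommutativeRing ring using (_^_)
  open Ops using (⟦_⟧; ⟦_⇓⟧; correct)
  open ≡-Reasoning

  [k+1]*nC[k+1]+k*nCk≡n*nCk : ∀ n k → suc k ℕ.* (n C suc k) ℕ.+ k ℕ.* (n C k) ≡ n ℕ.* (n C k)
  [k+1]*nC[k+1]+k*nCk≡n*nCk zero    zero    = refl
  [k+1]*nC[k+1]+k*nCk≡n*nCk zero    (suc k)
    rewrite k>n⇒nCk≡0 {0} {suc k} (ℕ.s≤s ℕ.z≤n) | k>n⇒nCk≡0 {0} {suc (suc k)} (ℕ.s≤s ℕ.z≤n)
    | ℕ.*-zeroʳ k = refl
  [k+1]*nC[k+1]+k*nCk≡n*nCk (suc n) zero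
    rewrite nC1≡n (suc n) = ℕ-Solver.solve (n ∷ [])
  [k+1]*nC[k+1]+k*nCk≡n*nCk (suc n) (suc j)
    rewrite sym (nCk+nC[k+1]≡[n+1]C[k+1] n j) | sym (nCk+nC[k+1]≡[n+1]C[k+1] n (suc j))
    = step n j (n C j) (n C suc j) (n C suc (suc j))
        ([k+1]*nC[k+1]+k*nCk≡n*nCk n j) ([k+1]*nC[k+1]+k*nCk≡n*nCk n (suc j))
    where
    step : ∀ n j a b e →
           (1 ℕ.+ j) ℕ.* b ℕ.+ j ℕ.* a ≡ n ℕ.* a → (2 ℕ.+ j) ℕ.* e ℕ.+ (1 ℕ.+ j) ℕ.* b ≡ n ℕ.* b →
           (2 ℕ.+ j) ℕ.* (b ℕ.+ e) ℕ.+ (1 ℕ.+ j) ℕ.* (a ℕ.+ b) ≡ (1 ℕ.+ n) ℕ.* (a ℕ.+ b)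
    step n j a b e lower upper = begin
      (2 ℕ.+ j) ℕ.* (b ℕ.+ e) ℕ.+ (1 ℕ.+ j) ℕ.* (a ℕ.+ b)
        ≡⟨ ℕ-Solver.solve (n ∷ j ∷ a ∷ b ∷ e ∷ []) ⟩
      ((2 ℕ.+ j) ℕ.* e ℕ.+ (1 ℕ.+ j) ℕ.* b) ℕ.+ ((1 ℕ.+ j) ℕ.* b ℕ.+ j ℕ.* a) ℕ.+ (a ℕ.+ b)
        ≡⟨ cong₂ (λ u v → u ℕ.+ v ℕ.+ (a ℕ.+ b)) upper lower ⟩
      n ℕ.* b ℕ.+ n ℕ.* a ℕ.+ (a ℕ.+ b)
        ≡⟨ ℕ-Solver.solve (n ∷ j ∷ a ∷ b ∷ e ∷ []) ⟩
      (1 ℕ.+ n) ℕ.* (a ℕ.+ b) ∎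

  infixl 9 _Cᶻ_
  _Cᶻ_ : ℕ → ℕ → ℤ
  n Cᶻ k = + (n C k)

  nCᶻk+nCᶻ[k+1]≡[n+1]Cᶻ[k+1] : ∀ n k → n Cᶻ k + n Cᶻ suc k ≡ suc n Cᶻ suc k
  nCᶻk+nCᶻ[k+1]≡[n+1]Cᶻ[k+1] n k = trans (sym (pos-+ (n C k) (n C suc k))) (cong +_ (nCk+nC[k+1]≡[n+1]C[k+1] n k))

  [k+1]*nCᶻ[k+1]≡[n-k]*nCᶻk : ∀ n k → + suc k * n Cᶻ suc k ≡ (+ n - + k) * n Cᶻ k
  [k+1]*nCᶻ[k+1]≡[n-k]*nCᶻk n k = move (+ suc k * n Cᶻ suc k) (+ k) (+ n) (n Cᶻ k) (begin
    + suc k * n Cᶻ suc k + + k * n Cᶻ k              ≡⟨ cong₂ _+_ (pos-* (suc k) (n C suc k)) (pos-* k (n C k)) ⟨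
    + (suc k ℕ.* (n C suc k)) + + (k ℕ.* (n C k))    ≡⟨ pos-+ (suc k ℕ.* (n C suc k)) (k ℕ.* (n C k)) ⟨
    + (suc k ℕ.* (n C suc k) ℕ.+ k ℕ.* (n C k))      ≡⟨ cong +_ ([k+1]*nC[k+1]+k*nCk≡n*nCk n k) ⟩
    + (n ℕ.* (n C k))                                ≡⟨ pos-* n (n C k) ⟩
    + n * n Cᶻ k                                     ∎)
    where
    move : ∀ u y x a → u + y * a ≡ x * a → u ≡ (x - y) * a
    move u y x a eq = begin
      u                 ≡⟨ solve (u ∷ y ∷ a ∷ []) ⟩
      u + y * a - y * a ≡⟨ cong (_- y * a) eq ⟩
      x * a - y * a     ≡⟨ solve (y ∷ x ∷ a ∷ []) ⟩
      (x - y) * a       ∎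

  [n+1]*nCᶻk≡[n+1-k]*[n+1]Cᶻk : ∀ n k → + suc n * n Cᶻ k ≡ (+ suc n - + k) * suc n Cᶻ k
  [n+1]*nCᶻk≡[n+1-k]*[n+1]Cᶻk n k = begin
    + suc n * n Cᶻ k                               ≡⟨ split (+ n) (+ k) (n Cᶻ k) ⟩
    + suc k * n Cᶻ k + (+ n - + k) * n Cᶻ k        ≡⟨ cong (_+_ (+ suc k * n Cᶻ k)) ([k+1]*nCᶻ[k+1]≡[n-k]*nCᶻk n k) ⟨
    + suc k * n Cᶻ k + + suc k * n Cᶻ suc k        ≡⟨ *-distribˡ-+ (+ suc k) (n Cᶻ k) (n Cᶻ suc k) ⟨
    + suc k * (n Cᶻ k + n Cᶻ suc k)                ≡⟨ cong (+ suc k *_) (nCᶻk+nCᶻ[k+1]≡[n+1]Cᶻ[k+1] n k) ⟩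
    + suc k * suc n Cᶻ suc k                       ≡⟨ [k+1]*nCᶻ[k+1]≡[n-k]*nCᶻk (suc n) k ⟩
    (+ suc n - + k) * suc n Cᶻ k                   ∎
    where
    split : ∀ x y a → (1ℤ + x) * a ≡ (1ℤ + y) * a + (x - y) * a
    split = solve-∀

  n*[n-1]Cᶻk≡[n-k]*nCᶻk : ∀ n k → + n * (n ℕ.∸ 1) Cᶻ k ≡ (+ n - + k) * n Cᶻ k
  n*[n-1]Cᶻk≡[n-k]*nCᶻk zero    zero    = refl
  n*[n-1]Cᶻk≡[n-k]*nCᶻk zero    (suc k) rewrite k>n⇒nCk≡0 {0} {suc k} (ℕ.s≤s ℕ.z≤n) = sym (*-zeroʳ (- + suc k))
  n*[n-1]Cᶻk≡[n-k]*nCᶻk (suc n) k       = [n+1]*nCᶻk≡[n+1-k]*[n+1]Cᶻk n k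

  central : ℕ → ℤ
  central k = (2 ℕ.* k) Cᶻ k

  catalan : ℕ → ℤ
  catalan k = central k - (2 ℕ.* k) Cᶻ suc k

  [k+1]*central[k+1]≡2[2k+1]*central : ∀ k → + suc k * central (suc k) ≡ + 2 * (+ 2 * + k + 1ℤ) * central k
  [k+1]*central[k+1]≡2[2k+1]*central k = trans (cong (λ n → + suc k * n Cᶻ suc k) (ℕ.*-suc 2 k))
    (ratio (+ (2 ℕ.* k)) (+ k) (central k) (suc (2 ℕ.* k) Cᶻ k) (suc (2 ℕ.* k) Cᶻ suc k) (suc (suc (2 ℕ.* k)) Cᶻ suc k)
      (pos-* 2 k)
      ([n+1]*nCᶻk≡[n+1-k]*[n+1]Cᶻk (2 ℕ.* k) k)
      ([k+1]*nCᶻ[k+1]≡[n-k]*nCᶻk (suc (2 ℕ.* k)) k)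
      ([n+1]*nCᶻk≡[n+1-k]*[n+1]Cᶻk (suc (2 ℕ.* k)) (suc k)))
    where
    ratio : ∀ x y a b e f → x ≡ + 2 * y →
            (1ℤ + x) * a ≡ (1ℤ + x - y) * b → (1ℤ + y) * e ≡ (1ℤ + x - y) * b →
            (1ℤ + (1ℤ + x)) * e ≡ (1ℤ + (1ℤ + x) - (1ℤ + y)) * f →
            (1ℤ + y) * f ≡ + 2 * (+ 2 * y + 1ℤ) * a
    ratio _ y a b e f refl row col diag = begin
      (1ℤ + y) * f                                        ≡⟨ solve (y ∷ f ∷ []) ⟩
      (1ℤ + (1ℤ + + 2 * y) - (1ℤ + y)) * f                ≡⟨ diag ⟨
      (1ℤ + (1ℤ + + 2 * y)) * e                           ≡⟨ solve (y ∷ e ∷ []) ⟩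
      + 2 * ((1ℤ + y) * e)                                ≡⟨ cong (+ 2 *_) col ⟩
      + 2 * ((1ℤ + + 2 * y - y) * b)                      ≡⟨ cong (+ 2 *_) row ⟨
      + 2 * ((1ℤ + + 2 * y) * a)                          ≡⟨ solve (y ∷ a ∷ []) ⟩
      + 2 * (+ 2 * y + 1ℤ) * a                            ∎

  [k+1]*catalan≡central : ∀ k → + suc k * catalan k ≡ central k
  [k+1]*catalan≡central k = cancel (+ (2 ℕ.* k)) (+ k) (central k) ((2 ℕ.* k) Cᶻ suc k)
    (pos-* 2 k) ([k+1]*nCᶻ[k+1]≡[n-k]*nCᶻk (2 ℕ.* k) k)
    where
    cancel : ∀ x y a b → x ≡ + 2 * y → (1ℤ + y) * b ≡ (x - y) * a → (1ℤ + y) * (a - b) ≡ a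
    cancel _ y a b refl absorb = begin
      (1ℤ + y) * (a - b)                ≡⟨ solve (y ∷ a ∷ b ∷ []) ⟩
      (1ℤ + y) * a - (1ℤ + y) * b       ≡⟨ cong (λ u → (1ℤ + y) * a - u) absorb ⟩
      (1ℤ + y) * a - (+ 2 * y - y) * a  ≡⟨ solve (y ∷ a ∷ []) ⟩
      a                                 ∎

  summand : ℕ → ℕ → ℤ
  summand m k = m Cᶻ k ^ 2 * central k

  summand-ratioₘ : ∀ m k → (+ suc m) ^ 2 * summand m k ≡ (+ suc m - + k) ^ 2 * summand (suc m) k
  summand-ratioₘ m k = ratio (+ suc m) (+ suc m - + k) (m Cᶻ k) (suc m Cᶻ k) (central k)
    ([n+1]*nCᶻk≡[n+1-k]*[n+1]Cᶻk m k)
    where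
    ratio : ∀ u v b b′ c → u * b ≡ v * b′ → u ^ 2 * (b ^ 2 * c) ≡ v ^ 2 * (b′ ^ 2 * c)
    ratio u v b b′ c eq = begin
      u ^ 2 * (b ^ 2 * c)    ≡⟨ solve (u ∷ b ∷ c ∷ []) ⟩
      (u * b) ^ 2 * c        ≡⟨ cong (λ t → t ^ 2 * c) eq ⟩
      (v * b′) ^ 2 * c       ≡⟨ solve (v ∷ b′ ∷ c ∷ []) ⟩
      v ^ 2 * (b′ ^ 2 * c)   ∎

  summand-ratioₖ : ∀ m k → (+ suc k) ^ 3 * summand m (suc k) ≡ + 2 * (+ 2 * + k + 1ℤ) * (+ m - + k) ^ 2 * summand m k
  summand-ratioₖ m k = ratio (+ suc k) (+ m - + k) (+ 2 * (+ 2 * + k + 1ℤ)) (m Cᶻ k) (m Cᶻ suc k) (central k) (central (suc k))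
    ([k+1]*nCᶻ[k+1]≡[n-k]*nCᶻk m k) ([k+1]*central[k+1]≡2[2k+1]*central k)
    where
    ratio : ∀ u v w b b′ c c′ → u * b′ ≡ v * b → u * c′ ≡ w * c → u ^ 3 * (b′ ^ 2 * c′) ≡ w * v ^ 2 * (b ^ 2 * c)
    ratio u v w b b′ c c′ eq₁ eq₂ = begin
      u ^ 3 * (b′ ^ 2 * c′)       ≡⟨ solve (u ∷ b′ ∷ c′ ∷ []) ⟩
      (u * b′) ^ 2 * (u * c′)     ≡⟨ cong₂ (λ s t → s ^ 2 * t) eq₁ eq₂ ⟩
      (v * b) ^ 2 * (w * c)       ≡⟨ solve (v ∷ w ∷ b ∷ c ∷ []) ⟩
      w * v ^ 2 * (b ^ 2 * c)     ∎

  sumBelowᶻ : ℕ → (ℕ → ℤ) → ℤ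
  sumBelowᶻ zero    f = 0ℤ
  sumBelowᶻ (suc n) f = sumBelowᶻ n f + f n

  sumBelowᶻ-cong : ∀ n {f g : ℕ → ℤ} → (∀ k → f k ≡ g k) → sumBelowᶻ n f ≡ sumBelowᶻ n g
  sumBelowᶻ-cong zero    f≡g = refl
  sumBelowᶻ-cong (suc n) f≡g = cong₂ _+_ (sumBelowᶻ-cong n f≡g) (f≡g n)

  sumBelowᶻ-+ : ∀ n (f g : ℕ → ℤ) → sumBelowᶻ n (λ k → f k + g k) ≡ sumBelowᶻ n f + sumBelowᶻ n g
  sumBelowᶻ-+ zero    f g = refl
  sumBelowᶻ-+ (suc n) f g = trans (cong (_+ (f n + g n)) (sumBelowᶻ-+ n f g))
    (interchange (sumBelowᶻ n f) (sumBelowᶻ n g) (f n) (g n))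
    where
    interchange : ∀ a b c d → a + b + (c + d) ≡ a + c + (b + d)
    interchange = solve-∀

  sumBelowᶻ-minus : ∀ n (f g : ℕ → ℤ) → sumBelowᶻ n (λ k → f k - g k) ≡ sumBelowᶻ n f - sumBelowᶻ n g
  sumBelowᶻ-minus zero    f g = refl
  sumBelowᶻ-minus (suc n) f g = trans (cong (_+ (f n - g n)) (sumBelowᶻ-minus n f g))
    (interchange (sumBelowᶻ n f) (sumBelowᶻ n g) (f n) (g n))
    where
    interchange : ∀ a b c d → a - b + (c - d) ≡ a + c - (b + d)
    interchange = solve-∀

  sumBelowᶻ-*ˡ : ∀ n a (f : ℕ → ℤ) → sumBelowᶻ n (λ k → a * f k) ≡ a * sumBelowᶻ n f
  sumBelowᶻ-*ˡ zero    a f = sym (*-zeroʳ a)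
  sumBelowᶻ-*ˡ (suc n) a f = trans (cong (_+ a * f n) (sumBelowᶻ-*ˡ n a f))
    (sym (*-distribˡ-+ a (sumBelowᶻ n f) (f n)))

  sumBelowᶻ-telescope : ∀ n {f} (g : ℕ → ℤ) → (∀ k → f k ≡ g (suc k) - g k) → sumBelowᶻ n f ≡ g n - g 0
  sumBelowᶻ-telescope zero    g step = sym (+-inverseʳ (g 0))
  sumBelowᶻ-telescope (suc n) {f} g step = begin
    sumBelowᶻ n f + f n                ≡⟨ cong₂ _+_ (sumBelowᶻ-telescope n g step) (step n) ⟩
    g n - g 0 + (g (suc n) - g n)      ≡⟨ collapse (g n) (g 0) (g (suc n)) ⟩
    g (suc n) - g 0                    ∎
    where
    collapse : ∀ a b c → a - b + (c - a) ≡ c - b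
    collapse = solve-∀

  weightedSum : (ℕ → ℤ) → ℕ → ℤ
  weightedSum ω m = sumBelowᶻ (suc m) (λ k → summand m k * ω k)

  module WZ (A : ℤ) (ω : ℕ → ℤ) where

    φ : (ℤ → ℕ → ℤ) → ℕ → ℤ → ℤ
    φ P k a = A * + suc k * ω k - (1ℤ + a) ^ 2 * P (1ℤ + a) k + (a - + k) ^ 2 * P a k

    -- (k+1) times F-difference below, divided by T(m+1,k).
    IsCertificate : ℤ → (ℤ → ℕ → ℤ) → (ℕ → ℤ → ℤ) → Set
    IsCertificate c P Q = ∀ m k →
      c * ((+ suc m - + k) ^ 2 * φ P k (+ m) - (+ suc m) ^ 2 * φ P k (+ suc m))
        ≡ + suc k * (+ 2 * (+ 2 * + k + 1ℤ) * (+ suc m - + k) ^ 2 * Q m (+ suc k) - (+ k) ^ 3 * Q m (+ k))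

    module Telescoping {c P Q} {{_ : NonZero c}} (certificate : IsCertificate c P Q) (P-initial : P 1ℤ 0 ≡ A * ω 0) where

      cofactorTerm : ℕ → ℕ → ℤ
      cofactorTerm m k = (m ℕ.∸ 1) Cᶻ k ^ 2 * catalan k * P (+ m) k

      cofactor : ℕ → ℤ
      cofactor m = sumBelowᶻ (suc m) (cofactorTerm m)

      F : ℕ → ℕ → ℤ
      F m k = A * (summand m k * ω k) - (+ suc m) ^ 2 * cofactorTerm (suc m) k + (+ m) ^ 2 * cofactorTerm m k

      G : ℕ → ℕ → ℤ
      G m k = (+ k) ^ 3 * summand (suc m) k * Q m (+ k)

      [k+1]*F≡summand*φ : ∀ m k → + suc k * F m k ≡ summand m k * φ P k (+ m)
      [k+1]*F≡summand*φ m k = absorb A (ω k) (+ m) (+ k) (m Cᶻ k) ((m ℕ.∸ 1) Cᶻ k) (catalan k) (central k)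
        (P (+ suc m) k) (P (+ m) k) ([k+1]*catalan≡central k) (n*[n-1]Cᶻk≡[n-k]*nCᶻk m k)
        where
        absorb : ∀ a w x y b b′ t t′ p₁ p₀ → (1ℤ + y) * t ≡ t′ → x * b′ ≡ (x - y) * b →
                (1ℤ + y) * (a * (b ^ 2 * t′ * w) - (1ℤ + x) ^ 2 * (b ^ 2 * t * p₁) + x ^ 2 * (b′ ^ 2 * t * p₀))
                  ≡ b ^ 2 * t′ * (a * (1ℤ + y) * w - (1ℤ + x) ^ 2 * p₁ + (x - y) ^ 2 * p₀)
        absorb a w x y b b′ t _ p₁ p₀ refl eq = begin
          (1ℤ + y) * (a * (b ^ 2 * ((1ℤ + y) * t) * w) - (1ℤ + x) ^ 2 * (b ^ 2 * t * p₁) + x ^ 2 * (b′ ^ 2 * t * p₀))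
            ≡⟨ solve (a ∷ w ∷ x ∷ y ∷ b ∷ b′ ∷ t ∷ p₁ ∷ p₀ ∷ []) ⟩
          b ^ 2 * ((1ℤ + y) * t) * (a * (1ℤ + y) * w - (1ℤ + x) ^ 2 * p₁) + (x * b′) ^ 2 * ((1ℤ + y) * t) * p₀
            ≡⟨ cong (λ u → b ^ 2 * ((1ℤ + y) * t) * (a * (1ℤ + y) * w - (1ℤ + x) ^ 2 * p₁) + u ^ 2 * ((1ℤ + y) * t) * p₀) eq ⟩
          b ^ 2 * ((1ℤ + y) * t) * (a * (1ℤ + y) * w - (1ℤ + x) ^ 2 * p₁) + ((x - y) * b) ^ 2 * ((1ℤ + y) * t) * p₀
            ≡⟨ solve (a ∷ w ∷ x ∷ y ∷ b ∷ t ∷ p₁ ∷ p₀ ∷ []) ⟩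
          b ^ 2 * ((1ℤ + y) * t) * (a * (1ℤ + y) * w - (1ℤ + x) ^ 2 * p₁ + (x - y) ^ 2 * p₀)
            ∎

      F-difference : ∀ m k → c * (+ suc m) ^ 2 * (F m k - F (suc m) k) ≡ G m (suc k) - G m k
      F-difference m k = *-cancelˡ-≡ (+ suc k) _ _ (combine c (+ m) (+ k)
        (summand m k) (summand (suc m) k) (summand (suc m) (suc k))
        (φ P k (+ m)) (φ P k (+ suc m)) (Q m (+ k)) (Q m (+ suc k)) (F m k) (F (suc m) k)
        ([k+1]*F≡summand*φ m k) ([k+1]*F≡summand*φ (suc m) k)
        (summand-ratioₘ m k) (certificate m k) (summand-ratioₖ (suc m) k))
        where
        combine : ∀ c x y t t′ t″ f f′ q q′ u u′ →
                (1ℤ + y) * u ≡ t * f → (1ℤ + y) * u′ ≡ t′ * f′ →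
                (1ℤ + x) ^ 2 * t ≡ (1ℤ + x - y) ^ 2 * t′ →
                c * ((1ℤ + x - y) ^ 2 * f - (1ℤ + x) ^ 2 * f′)
                  ≡ (1ℤ + y) * (+ 2 * (+ 2 * y + 1ℤ) * (1ℤ + x - y) ^ 2 * q′ - y ^ 3 * q) →
                (1ℤ + y) ^ 3 * t″ ≡ + 2 * (+ 2 * y + 1ℤ) * (1ℤ + x - y) ^ 2 * t′ →
                (1ℤ + y) * (c * (1ℤ + x) ^ 2 * (u - u′)) ≡ (1ℤ + y) * ((1ℤ + y) ^ 3 * t″ * q′ - y ^ 3 * t′ * q)
        combine c x y t t′ t″ f f′ q q′ u u′ eq₁ eq₂ ratioₘ wz ratioₖ = begin
          (1ℤ + y) * (c * (1ℤ + x) ^ 2 * (u - u′))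
            ≡⟨ solve (c ∷ x ∷ y ∷ u ∷ u′ ∷ []) ⟩
          c * (1ℤ + x) ^ 2 * ((1ℤ + y) * u) - c * (1ℤ + x) ^ 2 * ((1ℤ + y) * u′)
            ≡⟨ cong₂ (λ s s′ → c * (1ℤ + x) ^ 2 * s - c * (1ℤ + x) ^ 2 * s′) eq₁ eq₂ ⟩
          c * (1ℤ + x) ^ 2 * (t * f) - c * (1ℤ + x) ^ 2 * (t′ * f′)
            ≡⟨ solve (c ∷ x ∷ t ∷ t′ ∷ f ∷ f′ ∷ []) ⟩
          c * ((1ℤ + x) ^ 2 * t) * f - c * (1ℤ + x) ^ 2 * t′ * f′
            ≡⟨ cong (λ s → c * s * f - c * (1ℤ + x) ^ 2 * t′ * f′) ratioₘ ⟩
          c * ((1ℤ + x - y) ^ 2 * t′) * f - c * (1ℤ + x) ^ 2 * t′ * f′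
            ≡⟨ solve (c ∷ x ∷ y ∷ t′ ∷ f ∷ f′ ∷ []) ⟩
          t′ * (c * ((1ℤ + x - y) ^ 2 * f - (1ℤ + x) ^ 2 * f′))
            ≡⟨ cong (t′ *_) wz ⟩
          t′ * ((1ℤ + y) * (+ 2 * (+ 2 * y + 1ℤ) * (1ℤ + x - y) ^ 2 * q′ - y ^ 3 * q))
            ≡⟨ solve (x ∷ y ∷ t′ ∷ q ∷ q′ ∷ []) ⟩
          (1ℤ + y) * (+ 2 * (+ 2 * y + 1ℤ) * (1ℤ + x - y) ^ 2 * t′ * q′ - y ^ 3 * t′ * q)
            ≡⟨ cong (λ s → (1ℤ + y) * (s * q′ - y ^ 3 * t′ * q)) ratioₖ ⟨
          (1ℤ + y) * ((1ℤ + y) ^ 3 * t″ * q′ - y ^ 3 * t′ * q)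
            ∎

      summand-vanishes : ∀ {m k} → m ℕ.< k → summand m k ≡ 0ℤ
      summand-vanishes m<k rewrite k>n⇒nCk≡0 m<k = refl

      G-vanishes : ∀ m {n} → suc m ℕ.< n → G m n ≡ 0ℤ
      G-vanishes m {n} m<n rewrite summand-vanishes m<n = cong (_* Q m (+ n)) (*-zeroʳ ((+ n) ^ 3))

      ∑F-shift : ∀ m n → suc m ℕ.< n → sumBelowᶻ n (F m) ≡ sumBelowᶻ n (F (suc m))
      ∑F-shift m n m<n = i-j≡0⇒i≡j _ _ (*-cancelˡ-≡ ((+ suc m) ^ 2) _ 0ℤ (*-cancelˡ-≡ c _ _ (begin
        c * ((+ suc m) ^ 2 * (sumBelowᶻ n (F m) - sumBelowᶻ n (F (suc m))))
          ≡⟨ *-assoc c ((+ suc m) ^ 2) _ ⟨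
        c * (+ suc m) ^ 2 * (sumBelowᶻ n (F m) - sumBelowᶻ n (F (suc m)))
          ≡⟨ cong (c * (+ suc m) ^ 2 *_) (sumBelowᶻ-minus n (F m) (F (suc m))) ⟨
        c * (+ suc m) ^ 2 * sumBelowᶻ n (λ k → F m k - F (suc m) k)
          ≡⟨ sumBelowᶻ-*ˡ n (c * (+ suc m) ^ 2) (λ k → F m k - F (suc m) k) ⟨
        sumBelowᶻ n (λ k → c * (+ suc m) ^ 2 * (F m k - F (suc m) k))
          ≡⟨ sumBelowᶻ-telescope n (G m) (F-difference m) ⟩
        G m n - G m 0
          ≡⟨ cong (_- G m 0) (G-vanishes m m<n) ⟩
        0ℤ
          ≡⟨ trans (cong (c *_) (*-zeroʳ ((+ suc m) ^ 2))) (*-zeroʳ c) ⟨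
        c * ((+ suc m) ^ 2 * 0ℤ) ∎)))

      F-at-0 : ∀ k → F 0 k ≡ 0ℤ
      F-at-0 zero = collapse A (ω 0) (P 1ℤ 0) (cofactorTerm 0 0) P-initial
        where
        collapse : ∀ a w p t → p ≡ a * w → a * (1ℤ * w) - 1ℤ * (1ℤ * p) + 0ℤ * t ≡ 0ℤ
        collapse a w _ t refl = solve (a ∷ w ∷ t ∷ [])
      F-at-0 (suc k) rewrite k>n⇒nCk≡0 {0} {suc k} (ℕ.s≤s ℕ.z≤n) = collapse A
        where
        collapse : ∀ a → a * 0ℤ - 0ℤ + 0ℤ ≡ 0ℤ
        collapse = solve-∀

      ∑F-vanishes : ∀ m n → m ℕ.< n → sumBelowᶻ n (F m) ≡ 0ℤ
      ∑F-vanishes zero    n       _   = ∑F-at-0 n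
        where
        ∑F-at-0 : ∀ n → sumBelowᶻ n (F 0) ≡ 0ℤ
        ∑F-at-0 zero    = refl
        ∑F-at-0 (suc n) = cong₂ _+_ (∑F-at-0 n) (F-at-0 n)
      ∑F-vanishes (suc m) n m<n = trans (sym (∑F-shift m n m<n)) (∑F-vanishes m n (ℕ.<-trans (ℕ.n<1+n m) m<n))

      cofactor-suc : ∀ m → cofactor (suc m) ≡ sumBelowᶻ (suc m) (cofactorTerm (suc m))
      cofactor-suc m rewrite k>n⇒nCk≡0 (ℕ.n<1+n m) = +-identityʳ (sumBelowᶻ (suc m) (cofactorTerm (suc m)))

      ∑F-expansion : ∀ m → sumBelowᶻ (suc m) (F m)
                           ≡ A * weightedSum ω m - (+ suc m) ^ 2 * cofactor (suc m) + (+ m) ^ 2 * cofactor m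
      ∑F-expansion m = begin
        sumBelowᶻ (suc m) (λ k → A * t k - M² * u k + x² * v k)
          ≡⟨ sumBelowᶻ-+ (suc m) (λ k → A * t k - M² * u k) (λ k → x² * v k) ⟩
        sumBelowᶻ (suc m) (λ k → A * t k - M² * u k) + sumBelowᶻ (suc m) (λ k → x² * v k)
          ≡⟨ cong₂ _+_ (sumBelowᶻ-minus (suc m) (λ k → A * t k) (λ k → M² * u k)) (sumBelowᶻ-*ˡ (suc m) x² v) ⟩
        sumBelowᶻ (suc m) (λ k → A * t k) - sumBelowᶻ (suc m) (λ k → M² * u k) + x² * cofactor m
          ≡⟨ cong₂ (λ p q → p - q + x² * cofactor m) (sumBelowᶻ-*ˡ (suc m) A t) (sumBelowᶻ-*ˡ (suc m) M² u) ⟩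
        A * weightedSum ω m - M² * sumBelowᶻ (suc m) u + x² * cofactor m
          ≡⟨ cong (λ p → A * weightedSum ω m - M² * p + x² * cofactor m) (cofactor-suc m) ⟨
        A * weightedSum ω m - M² * cofactor (suc m) + x² * cofactor m
          ∎
        where
        M² x² : ℤ
        M² = (+ suc m) ^ 2
        x² = (+ m) ^ 2
        t u v : ℕ → ℤ
        t k = summand m k * ω k
        u   = cofactorTerm (suc m)
        v   = cofactorTerm m

      weightedSum-recurrence : ∀ m → A * weightedSum ω m + (+ m) ^ 2 * cofactor m ≡ (+ suc m) ^ 2 * cofactor (suc m)
      weightedSum-recurrence m = rearrange (A * weightedSum ω m) ((+ suc m) ^ 2 * cofactor (suc m)) ((+ m) ^ 2 * cofactor m)
        (trans (sym (∑F-expansion m)) (∑F-vanishes m (suc m) (ℕ.n<1+n m)))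
        where
        rearrange : ∀ a b e → a - b + e ≡ 0ℤ → a + e ≡ b
        rearrange a b e eq = begin
          a + e             ≡⟨ solve (a ∷ b ∷ e ∷ []) ⟩
          a - b + e + b     ≡⟨ cong (_+ b) eq ⟩
          0ℤ + b            ≡⟨ solve (b ∷ []) ⟩
          b                 ∎

      A*∑weightedSum≡n²*cofactor : ∀ n → A * sumBelowᶻ n (weightedSum ω) ≡ (+ n) ^ 2 * cofactor n
      A*∑weightedSum≡n²*cofactor zero    = *-zeroʳ A
      A*∑weightedSum≡n²*cofactor (suc n) = begin
        A * (sumBelowᶻ n (weightedSum ω) + weightedSum ω n)
          ≡⟨ *-distribˡ-+ A (sumBelowᶻ n (weightedSum ω)) (weightedSum ω n) ⟩
        A * sumBelowᶻ n (weightedSum ω) + A * weightedSum ω n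
          ≡⟨ cong (_+ A * weightedSum ω n) (A*∑weightedSum≡n²*cofactor n) ⟩
        (+ n) ^ 2 * cofactor n + A * weightedSum ω n
          ≡⟨ +-comm ((+ n) ^ 2 * cofactor n) (A * weightedSum ω n) ⟩
        A * weightedSum ω n + (+ n) ^ 2 * cofactor n
          ≡⟨ weightedSum-recurrence n ⟩
        (+ suc n) ^ 2 * cofactor (suc n)
          ∎

  weight : ℕ → ℕ → ℤ
  weight s k = (+ 2 * + k + 1ℤ) ^ s

  pos-^ : ∀ n s → + (n ℕ.^ s) ≡ (+ n) ^ s
  pos-^ n zero          = refl
  pos-^ n (suc zero)    = cong +_ (ℕ.*-identityʳ n)
  pos-^ n (suc (suc s)) = begin
    + (n ℕ.* n ℕ.^ suc s)   ≡⟨ pos-* n (n ℕ.^ suc s) ⟩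
    + n * + (n ℕ.^ suc s)   ≡⟨ cong (+ n *_) (pos-^ n (suc s)) ⟩
    + n * (+ n) ^ suc s     ≡⟨ *-comm (+ n) ((+ n) ^ suc s) ⟩
    (+ n) ^ suc s * + n     ∎

  pos-sumBelow : ∀ n f → + sumBelow n f ≡ sumBelowᶻ n (λ k → + f k)
  pos-sumBelow zero    f = refl
  pos-sumBelow (suc n) f = trans (pos-+ (sumBelow n f) (f n)) (cong (_+ + f n) (pos-sumBelow n f))

  pos-sumTo : ∀ m f → + sumTo m f ≡ sumBelowᶻ (suc m) (λ k → + f k)
  pos-sumTo zero    f = refl
  pos-sumTo (suc m) f = trans (pos-+ (sumTo m f) (f (suc m))) (cong (_+ + f (suc m)) (pos-sumTo m f))

  pos-S : ∀ s m → + S s m ≡ weightedSum (weight s) m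
  pos-S s m = trans (pos-sumTo m _) (sumBelowᶻ-cong (suc m) pos-summand)
    where
    pos-summand : ∀ k → + ((m C k) ℕ.^ 2 ℕ.* ((2 ℕ.* k) C k) ℕ.* (2 ℕ.* k ℕ.+ 1) ℕ.^ s) ≡ summand m k * weight s k
    pos-summand k = begin
      + ((m C k) ℕ.^ 2 ℕ.* ((2 ℕ.* k) C k) ℕ.* (2 ℕ.* k ℕ.+ 1) ℕ.^ s)
        ≡⟨ pos-* ((m C k) ℕ.^ 2 ℕ.* ((2 ℕ.* k) C k)) ((2 ℕ.* k ℕ.+ 1) ℕ.^ s) ⟩
      + ((m C k) ℕ.^ 2 ℕ.* ((2 ℕ.* k) C k)) * + ((2 ℕ.* k ℕ.+ 1) ℕ.^ s)
        ≡⟨ cong₂ _*_ (pos-* ((m C k) ℕ.^ 2) ((2 ℕ.* k) C k)) (pos-^ (2 ℕ.* k ℕ.+ 1) s) ⟩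
      + ((m C k) ℕ.^ 2) * central k * (+ (2 ℕ.* k ℕ.+ 1)) ^ s
        ≡⟨ cong₂ (λ u v → u * central k * v ^ s) (pos-^ (m C k) 2) (trans (pos-+ (2 ℕ.* k) 1) (cong (_+ 1ℤ) (pos-* 2 k))) ⟩
      summand m k * weight s k
        ∎

  ∣-from-ℤ : ∀ {d x} w → + x ≡ + d * w → d ℕ.∣ x
  ∣-from-ℤ {d} {x} w eq = ℕ.divides ∣ w ∣ (begin
    x                ≡⟨ cong ∣_∣ eq ⟩
    ∣ + d * w ∣      ≡⟨ abs-* (+ d) w ⟩
    d ℕ.* ∣ w ∣      ≡⟨ ℕ.*-comm d ∣ w ∣ ⟩
    ∣ w ∣ ℕ.* d      ∎)

  module _ {a s c P Q} {{_ : NonZero c}}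
           (certificate : WZ.IsCertificate (+ a) (weight s) c P Q) (P-initial : P 1ℤ 0 ≡ + a * weight s 0) where

    open WZ.Telescoping (+ a) (weight s) {c} {P} {Q} certificate P-initial

    certificate⇒n²∣a*∑S : ∀ n → n ℕ.^ 2 ℕ.∣ a ℕ.* sumBelow n (S s)
    certificate⇒n²∣a*∑S n = ∣-from-ℤ (cofactor n) (begin
      + (a ℕ.* sumBelow n (S s))                      ≡⟨ pos-* a (sumBelow n (S s)) ⟩
      + a * + sumBelow n (S s)                        ≡⟨ cong (+ a *_) (trans (pos-sumBelow n (S s)) (sumBelowᶻ-cong n (pos-S s))) ⟩
      + a * sumBelowᶻ n (weightedSum (weight s))      ≡⟨ A*∑weightedSum≡n²*cofactor n ⟩
      (+ n) ^ 2 * cofactor n                          ≡⟨ cong (_* cofactor n) (pos-^ n 2) ⟨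
      + (n ℕ.^ 2) * cofactor n                        ∎)

  δ₃ : ℕ → ℤ
  δ₃ k = sumBelowᶻ k (λ j → + j * + suc j)

  δ₅ : ℕ → ℤ
  δ₅ k = sumBelowᶻ k (λ j → + j * + suc j * (1ℤ + + j * + suc j))

  3*δ₃≡k³-k : ∀ k → + 3 * δ₃ k ≡ (+ k) ^ 3 - + k
  3*δ₃≡k³-k k = begin
    + 3 * δ₃ k                                  ≡⟨ sumBelowᶻ-*ˡ k (+ 3) _ ⟨
    sumBelowᶻ k (λ j → + 3 * (+ j * + suc j))   ≡⟨ sumBelowᶻ-telescope k (λ j → (+ j) ^ 3 - + j) (λ j → step (+ j)) ⟩
    (+ k) ^ 3 - + k - 0ℤ                        ≡⟨ +-identityʳ ((+ k) ^ 3 - + k) ⟩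
    (+ k) ^ 3 - + k                             ∎
    where
    step : ∀ x → + 3 * (x * (1ℤ + x)) ≡ ((1ℤ + x) ^ 3 - (1ℤ + x)) - (x ^ 3 - x)
    step = solve-∀

  5*δ₅≡k⁵-k : ∀ k → + 5 * δ₅ k ≡ (+ k) ^ 5 - + k
  5*δ₅≡k⁵-k k = begin
    + 5 * δ₅ k
      ≡⟨ sumBelowᶻ-*ˡ k (+ 5) _ ⟨
    sumBelowᶻ k (λ j → + 5 * (+ j * + suc j * (1ℤ + + j * + suc j)))
      ≡⟨ sumBelowᶻ-telescope k (λ j → (+ j) ^ 5 - + j) (λ j → step (+ j)) ⟩
    (+ k) ^ 5 - + k - 0ℤ
      ≡⟨ +-identityʳ ((+ k) ^ 5 - + k) ⟩
    (+ k) ^ 5 - + k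
      ∎
    where
    step : ∀ x → + 5 * (x * (1ℤ + x) * (1ℤ + x * (1ℤ + x))) ≡ ((1ℤ + x) ^ 5 - (1ℤ + x)) - (x ^ 5 - x)
    step = solve-∀

  infixl 9 _[_]
  _[_] : ∀ {n m} → Expr ℤ n → Vec (Expr ℤ m) n → Expr ℤ m
  Κ a     [ σ ] = Κ a
  Ι i     [ σ ] = Vec.lookup σ i
  (e ⊕ f) [ σ ] = e [ σ ] ⊕ f [ σ ]
  (e ⊗ f) [ σ ] = e [ σ ] ⊗ f [ σ ]
  (e ⊛ i) [ σ ] = e [ σ ] ⊛ i
  (⊝ e)   [ σ ] = ⊝ e [ σ ]

  ⟦[]⟧ : ∀ {n m} (e : Expr ℤ n) (σ : Vec (Expr ℤ m) n) ρ →
         ⟦ e [ σ ] ⟧ ρ ≡ ⟦ e ⟧ (Vec.map (λ t → ⟦ t ⟧ ρ) σ)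
  ⟦[]⟧ (Κ a)   σ ρ = refl
  ⟦[]⟧ (Ι i)   σ ρ = sym (lookup-map i (λ t → ⟦ t ⟧ ρ) σ)
  ⟦[]⟧ (e ⊕ f) σ ρ = cong₂ _+_ (⟦[]⟧ e σ ρ) (⟦[]⟧ f σ ρ)
  ⟦[]⟧ (e ⊗ f) σ ρ = cong₂ _*_ (⟦[]⟧ e σ ρ) (⟦[]⟧ f σ ρ)
  ⟦[]⟧ (e ⊛ i) σ ρ = cong (_^ i) (⟦[]⟧ e σ ρ)
  ⟦[]⟧ (⊝ e)   σ ρ = cong -_ (⟦[]⟧ e σ ρ)

  -- (c , i , j , k , l) stands for c xⁱ yʲ zᵏ wˡ.
  Monomial : Set
  Monomial = ℤ × ℕ × ℕ × ℕ × ℕ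

  record Certificate (A : ℤ) (s : ℕ) : Set where
    field
      scale     : ℤ
      P Q F₃ F₅ : List Monomial

  module _ where
    -- Opened only here: overloaded with List's constructors they make each `solve` call very slow.
    open import Data.Vec.Base using ([]; _∷_)

    X Y Z W one two : Expr ℤ 4
    X   = Ι Fin.zero
    Y   = Ι (Fin.suc Fin.zero)
    Z   = Ι (Fin.suc (Fin.suc Fin.zero))
    W   = Ι (Fin.suc (Fin.suc (Fin.suc Fin.zero)))
    one = Κ 1ℤ
    two = Κ (+ 2)

    polynomial : List Monomial → Expr ℤ 4
    polynomial []                      = Κ 0ℤ
    polynomial ((a , i , j , k , l) ∷ ms) = Κ a ⊗ X ⊛ i ⊗ Y ⊛ j ⊗ Z ⊛ k ⊗ W ⊛ l ⊕ polynomial ms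

    module Checked {a s} (cert : Certificate (+ a) s) where
      open Certificate cert

      point : ℕ → ℕ → Vec ℤ 4
      point m k = + m ∷ + k ∷ δ₃ k ∷ δ₅ k ∷ []

      Pᶻ : ℤ → ℕ → ℤ
      Pᶻ x k = ⟦ polynomial P ⟧ (x ∷ + k ∷ δ₃ k ∷ δ₅ k ∷ [])

      Qᶻ : ℕ → ℤ → ℤ
      Qᶻ m y = ⟦ polynomial Q ⟧ (+ m ∷ y ∷ 0ℤ ∷ 0ℤ ∷ [])

      P-at : Expr ℤ 4 → Expr ℤ 4
      P-at e = polynomial P [ e ∷ Y ∷ Z ∷ W ∷ [] ]

      Q-at : Expr ℤ 4 → Expr ℤ 4
      Q-at e = polynomial Q [ X ∷ e ∷ Κ 0ℤ ∷ Κ 0ℤ ∷ [] ]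

      φᴱ : Expr ℤ 4 → Expr ℤ 4
      φᴱ e = Κ (+ a) ⊗ (one ⊕ Y) ⊗ (two ⊗ Y ⊕ one) ⊛ s
             ⊕ ⊝ ((one ⊕ e) ⊛ 2 ⊗ P-at (one ⊕ e))
             ⊕ (e ⊕ ⊝ Y) ⊛ 2 ⊗ P-at e

      lhsᴱ rhsᴱ : Expr ℤ 4
      lhsᴱ = Κ scale ⊗ ((one ⊕ X ⊕ ⊝ Y) ⊛ 2 ⊗ φᴱ X ⊕ ⊝ ((one ⊕ X) ⊛ 2 ⊗ φᴱ (one ⊕ X)))
      rhsᴱ = (one ⊕ Y) ⊗ (two ⊗ (two ⊗ Y ⊕ one) ⊗ (one ⊕ X ⊕ ⊝ Y) ⊛ 2 ⊗ Q-at (one ⊕ Y)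
                          ⊕ ⊝ (Y ⊛ 3 ⊗ Q-at Y))

      fermatᴱ : ℕ → Expr ℤ 4 → Expr ℤ 4
      fermatᴱ p v = Κ (+ p) ⊗ v ⊕ ⊝ (Y ⊛ p ⊕ ⊝ Y)

      -- scale·(lhsᴱ − rhsᴱ) vanishes modulo 3z = y³ − y and 5w = y⁵ − y, with multipliers F₃ and F₅.
      checkᴱ : Expr ℤ 4
      checkᴱ = Κ scale ⊗ (lhsᴱ ⊕ ⊝ rhsᴱ) ⊕ ⊝ (fermatᴱ 3 Z ⊗ polynomial F₃ ⊕ fermatᴱ 5 W ⊗ polynomial F₅)

      module _ (m k : ℕ) where
        ρ : Vec ℤ 4
        ρ = point m k

        ⟦P-at⟧ : ∀ e → ⟦ P-at e ⟧ ρ ≡ Pᶻ (⟦ e ⟧ ρ) k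
        ⟦P-at⟧ e = ⟦[]⟧ (polynomial P) (e ∷ Y ∷ Z ∷ W ∷ []) ρ

        ⟦Q-at⟧ : ∀ e → ⟦ Q-at e ⟧ ρ ≡ Qᶻ m (⟦ e ⟧ ρ)
        ⟦Q-at⟧ e = ⟦[]⟧ (polynomial Q) (X ∷ e ∷ Κ 0ℤ ∷ Κ 0ℤ ∷ []) ρ

        ⟦φᴱ⟧ : ∀ e → ⟦ φᴱ e ⟧ ρ ≡ WZ.φ (+ a) (weight s) Pᶻ k (⟦ e ⟧ ρ)
        ⟦φᴱ⟧ e = cong₂ (λ p p′ → + a * + suc k * weight s k - (1ℤ + ⟦ e ⟧ ρ) ^ 2 * p + (⟦ e ⟧ ρ - + k) ^ 2 * p′)
                       (⟦P-at⟧ (one ⊕ e)) (⟦P-at⟧ e)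

        ⟦lhsᴱ⟧ : ⟦ lhsᴱ ⟧ ρ ≡ scale * ((+ suc m - + k) ^ 2 * WZ.φ (+ a) (weight s) Pᶻ k (+ m)
                                       - (+ suc m) ^ 2 * WZ.φ (+ a) (weight s) Pᶻ k (+ suc m))
        ⟦lhsᴱ⟧ = cong₂ (λ f f′ → scale * ((+ suc m - + k) ^ 2 * f - (+ suc m) ^ 2 * f′))
                       (⟦φᴱ⟧ X) (⟦φᴱ⟧ (one ⊕ X))

        ⟦rhsᴱ⟧ : ⟦ rhsᴱ ⟧ ρ
                 ≡ + suc k * (+ 2 * (+ 2 * + k + 1ℤ) * (+ suc m - + k) ^ 2 * Qᶻ m (+ suc k) - (+ k) ^ 3 * Qᶻ m (+ k))
        ⟦rhsᴱ⟧ = cong₂ (λ q′ q → + suc k * (+ 2 * (+ 2 * + k + 1ℤ) * (+ suc m - + k) ^ 2 * q′ - (+ k) ^ 3 * q))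
                       (⟦Q-at⟧ (one ⊕ Y)) (⟦Q-at⟧ Y)

        ⟦fermatᴱ₃⟧ : ⟦ fermatᴱ 3 Z ⟧ ρ ≡ 0ℤ
        ⟦fermatᴱ₃⟧ = trans (cong (_- ((+ k) ^ 3 - + k)) (3*δ₃≡k³-k k)) (+-inverseʳ ((+ k) ^ 3 - + k))

        ⟦fermatᴱ₅⟧ : ⟦ fermatᴱ 5 W ⟧ ρ ≡ 0ℤ
        ⟦fermatᴱ₅⟧ = trans (cong (_- ((+ k) ^ 5 - + k)) (5*δ₅≡k⁵-k k)) (+-inverseʳ ((+ k) ^ 5 - + k))

      checkᴱ-sound : {{_ : NonZero scale}} → (∀ ρ → ⟦ checkᴱ ⇓⟧ ρ ≡ 0ℤ) →
                     WZ.IsCertificate (+ a) (weight s) scale Pᶻ Qᶻ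
      checkᴱ-sound vanishes m k = begin
        _                  ≡⟨ ⟦lhsᴱ⟧ m k ⟨
        ⟦ lhsᴱ ⟧ (point m k) ≡⟨ cancel scale _ _ _ _ _ _ (trans (sym (correct checkᴱ (point m k))) (vanishes (point m k)))
                                        (⟦fermatᴱ₃⟧ m k) (⟦fermatᴱ₅⟧ m k) ⟩
        ⟦ rhsᴱ ⟧ (point m k) ≡⟨ ⟦rhsᴱ⟧ m k ⟩
        _                  ∎
        where
        cancel : ∀ c u v z₃ z₅ f g .{{_ : NonZero c}} →
                 c * (u - v) - (z₃ * f + z₅ * g) ≡ 0ℤ → z₃ ≡ 0ℤ → z₅ ≡ 0ℤ → u ≡ v
        cancel c u v _ _ f g eq refl refl = i-j≡0⇒i≡j u v
          (*-cancelˡ-≡ c (u - v) 0ℤ (trans (sym (+-identityʳ (c * (u - v)))) (trans eq (sym (*-zeroʳ c)))))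

      n²∣a*∑S : {{_ : NonZero scale}} → (∀ ρ → ⟦ checkᴱ ⇓⟧ ρ ≡ 0ℤ) → Pᶻ 1ℤ 0 ≡ + a * weight s 0 →
                     ∀ n → n ℕ.^ 2 ℕ.∣ a ℕ.* sumBelow n (S s)
      n²∣a*∑S vanishes initial =
        certificate⇒n²∣a*∑S {a = a} {s = s} {c = scale} {P = Pᶻ} {Q = Qᶻ} (checkᴱ-sound vanishes) initial

open import Data.Integer.Base using (+_; -_)
open import Data.List.Base using ([]; _∷_)
open import Data.Nat.Base using (ℕ; suc; _*_; _∸_; _^_; _≤_; NonZero; s≤s)
open import Data.Nat.Divisibility using (_∣_)
open import Data.Product.Base using (_,_)
open import Relation.Binary.PropositionalEquality using (refl)

open WZ-Method using (Certificate; module Checked)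

certificate₃ : Certificate (+ 3) 3
certificate₃ = record
  { scale = + 1
  ; P  = (+ 11 , 0 , 0 , 0 , 0) ∷ (+ 48 , 0 , 1 , 0 , 0) ∷ (+ 60 , 0 , 2 , 0 , 0) ∷
         (+ 24 , 0 , 3 , 0 , 0) ∷ (- + 8 , 1 , 0 , 0 , 0) ∷ (- + 24 , 1 , 1 , 0 , 0) ∷
         (- + 16 , 1 , 2 , 0 , 0) ∷ []
  ; Q  = (- + 1 , 0 , 0 , 0 , 0) ∷ (- + 8 , 0 , 1 , 0 , 0) ∷ (- + 12 , 0 , 2 , 0 , 0) ∷
         (+ 8 , 0 , 3 , 0 , 0) ∷ (- + 8 , 1 , 1 , 0 , 0) ∷ (- + 16 , 1 , 2 , 0 , 0) ∷ []
  ; F₃ = []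
  ; F₅ = []
  }

certificate₅ : Certificate (+ 15) 5
certificate₅ = record
  { scale = + 1
  ; P  = (+ 31 , 0 , 0 , 0 , 0) ∷ (+ 384 , 0 , 1 , 0 , 0) ∷ (+ 1416 , 0 , 2 , 0 , 0) ∷
         (+ 2064 , 0 , 3 , 0 , 0) ∷ (+ 1296 , 0 , 4 , 0 , 0) ∷ (+ 288 , 0 , 5 , 0 , 0) ∷
         (- + 16 , 1 , 0 , 0 , 0) ∷ (- + 240 , 1 , 1 , 0 , 0) ∷ (- + 704 , 1 , 2 , 0 , 0) ∷
         (- + 672 , 1 , 3 , 0 , 0) ∷ (- + 192 , 1 , 4 , 0 , 0) ∷ []
  ; Q  = (+ 7 , 0 , 0 , 0 , 0) ∷ (+ 80 , 0 , 1 , 0 , 0) ∷ (+ 120 , 0 , 2 , 0 , 0) ∷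
         (- + 176 , 0 , 3 , 0 , 0) ∷ (- + 144 , 0 , 4 , 0 , 0) ∷ (+ 96 , 0 , 5 , 0 , 0) ∷
         (+ 80 , 1 , 1 , 0 , 0) ∷ (+ 160 , 1 , 2 , 0 , 0) ∷ (- + 96 , 1 , 3 , 0 , 0) ∷
         (- + 192 , 1 , 4 , 0 , 0) ∷ []
  ; F₃ = []
  ; F₅ = []
  }

certificate₇ : Certificate (+ 21) 7
certificate₇ = record
  { scale = + 1
  ; P  = (+ 125 , 0 , 0 , 0 , 0) ∷ (+ 912 , 0 , 1 , 0 , 0) ∷ (+ 4380 , 0 , 2 , 0 , 0) ∷
         (+ 13848 , 0 , 3 , 0 , 0) ∷ (+ 22608 , 0 , 4 , 0 , 0) ∷ (+ 18720 , 0 , 5 , 0 , 0) ∷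
         (+ 7488 , 0 , 6 , 0 , 0) ∷ (+ 1152 , 0 , 7 , 0 , 0) ∷ (- + 104 , 1 , 0 , 0 , 0) ∷
         (- + 504 , 1 , 1 , 0 , 0) ∷ (- + 2416 , 1 , 2 , 0 , 0) ∷ (- + 6816 , 1 , 3 , 0 , 0) ∷
         (- + 8256 , 1 , 4 , 0 , 0) ∷ (- + 4224 , 1 , 5 , 0 , 0) ∷ (- + 768 , 1 , 6 , 0 , 0) ∷ []
  ; Q  = (- + 31 , 0 , 0 , 0 , 0) ∷ (- + 392 , 0 , 1 , 0 , 0) ∷ (- + 588 , 0 , 2 , 0 , 0) ∷
         (+ 1064 , 0 , 3 , 0 , 0) ∷ (+ 1008 , 0 , 4 , 0 , 0) ∷ (- + 1056 , 0 , 5 , 0 , 0) ∷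
         (- + 576 , 0 , 6 , 0 , 0) ∷ (+ 384 , 0 , 7 , 0 , 0) ∷ (- + 392 , 1 , 1 , 0 , 0) ∷
         (- + 784 , 1 , 2 , 0 , 0) ∷ (+ 672 , 1 , 3 , 0 , 0) ∷ (+ 1344 , 1 , 4 , 0 , 0) ∷
         (- + 384 , 1 , 5 , 0 , 0) ∷ (- + 768 , 1 , 6 , 0 , 0) ∷ []
  ; F₃ = []
  ; F₅ = []
  }

certificate₉ : Certificate (+ 15) 9
certificate₉ = record
  { scale = + 3
  ; P  = (- + 209 , 0 , 0 , 0 , 0) ∷ (+ 384 , 0 , 1 , 0 , 0) ∷ (+ 6096 , 0 , 2 , 0 , 0) ∷
         (+ 21664 , 0 , 3 , 0 , 0) ∷ (+ 64096 , 0 , 4 , 0 , 0) ∷ (+ 122048 , 0 , 5 , 0 , 0) ∷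
         (+ 129280 , 0 , 6 , 0 , 0) ∷ (+ 74240 , 0 , 7 , 0 , 0) ∷ (+ 21760 , 0 , 8 , 0 , 0) ∷
         (+ 2560 , 0 , 9 , 0 , 0) ∷ (+ 224 , 1 , 0 , 0 , 0) ∷ (- + 219456 , 1 , 0 , 1 , 0) ∷
         (- + 73632 , 1 , 1 , 0 , 0) ∷ (- + 210816 , 1 , 1 , 1 , 0) ∷ (- + 73856 , 1 , 2 , 0 , 0) ∷
         (- + 186880 , 1 , 2 , 1 , 0) ∷ (- + 115200 , 1 , 3 , 1 , 0) ∷ (- + 38400 , 1 , 4 , 1 , 0) ∷
         (- + 5120 , 1 , 5 , 1 , 0) ∷ []
  ; Q  = (+ 381 , 0 , 0 , 0 , 0) ∷ (+ 4960 , 0 , 1 , 0 , 0) ∷ (+ 7440 , 0 , 2 , 0 , 0) ∷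
         (- + 14368 , 0 , 3 , 0 , 0) ∷ (- + 14112 , 0 , 4 , 0 , 0) ∷ (+ 17088 , 0 , 5 , 0 , 0) ∷
         (+ 11520 , 0 , 6 , 0 , 0) ∷ (- + 10240 , 0 , 7 , 0 , 0) ∷ (- + 3840 , 0 , 8 , 0 , 0) ∷
         (+ 2560 , 0 , 9 , 0 , 0) ∷ (+ 4960 , 1 , 1 , 0 , 0) ∷ (+ 9920 , 1 , 2 , 0 , 0) ∷
         (- + 9408 , 1 , 3 , 0 , 0) ∷ (- + 18816 , 1 , 4 , 0 , 0) ∷ (+ 7680 , 1 , 5 , 0 , 0) ∷
         (+ 15360 , 1 , 6 , 0 , 0) ∷ (- + 2560 , 1 , 7 , 0 , 0) ∷ (- + 5120 , 1 , 8 , 0 , 0) ∷ []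
  ; F₃ = (- + 3950208 , 0 , 0 , 0 , 0) ∷ (- + 6428160 , 0 , 1 , 0 , 0) ∷ (- + 4576896 , 0 , 2 , 0 , 0) ∷
         (- + 3051264 , 0 , 3 , 0 , 0) ∷ (- + 952320 , 0 , 4 , 0 , 0) ∷ (+ 138240 , 0 , 5 , 0 , 0) ∷
         (+ 168960 , 0 , 6 , 0 , 0) ∷ (+ 30720 , 0 , 7 , 0 , 0) ∷ (- + 11850624 , 1 , 0 , 0 , 0) ∷
         (- + 21917952 , 1 , 1 , 0 , 0) ∷ (- + 16918848 , 1 , 2 , 0 , 0) ∷
         (- + 10712064 , 1 , 3 , 0 , 0) ∷ (- + 4193472 , 1 , 4 , 0 , 0) ∷ (+ 97152 , 1 , 5 , 0 , 0) ∷
         (+ 460800 , 1 , 6 , 0 , 0) ∷ (- + 38400 , 1 , 7 , 0 , 0) ∷ (- + 84480 , 1 , 8 , 0 , 0) ∷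
         (- + 15360 , 1 , 9 , 0 , 0) ∷ (- + 11850624 , 2 , 0 , 0 , 0) ∷ (- + 25868160 , 2 , 1 , 0 , 0) ∷
         (- + 24005376 , 2 , 2 , 0 , 0) ∷ (- + 15921408 , 2 , 3 , 0 , 0) ∷
         (- + 7147008 , 2 , 4 , 0 , 0) ∷ (- + 568320 , 2 , 5 , 0 , 0) ∷ (+ 1044480 , 2 , 6 , 0 , 0) ∷
         (+ 460800 , 2 , 7 , 0 , 0) ∷ (+ 61440 , 2 , 8 , 0 , 0) ∷ (- + 3950208 , 3 , 0 , 0 , 0) ∷
         (- + 10378368 , 3 , 1 , 0 , 0) ∷ (- + 12321792 , 3 , 2 , 0 , 0) ∷
         (- + 10209792 , 3 , 3 , 0 , 0) ∷ (- + 6389760 , 3 , 4 , 0 , 0) ∷ (- + 2626560 , 3 , 5 , 0 , 0) ∷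
         (- + 614400 , 3 , 6 , 0 , 0) ∷ (- + 61440 , 3 , 7 , 0 , 0) ∷ []
  ; F₅ = []
  }

certificate₁₁ : Certificate (+ 33) 11
certificate₁₁ = record
  { scale = + 1
  ; P  = (+ 5209 , 0 , 0 , 0 , 0) ∷ (+ 9744 , 0 , 1 , 0 , 0) ∷ (+ 12036 , 0 , 2 , 0 , 0) ∷
         (+ 168936 , 0 , 3 , 0 , 0) ∷ (+ 454368 , 0 , 4 , 0 , 0) ∷ (+ 911040 , 0 , 5 , 0 , 0) ∷
         (+ 1819776 , 0 , 6 , 0 , 0) ∷ (+ 2450688 , 0 , 7 , 0 , 0) ∷ (+ 1908480 , 0 , 8 , 0 , 0) ∷
         (+ 837120 , 0 , 9 , 0 , 0) ∷ (+ 193536 , 0 , 10 , 0 , 0) ∷ (+ 18432 , 0 , 11 , 0 , 0) ∷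
         (- + 5176 , 1 , 0 , 0 , 0) ∷ (- + 1320 , 1 , 1 , 0 , 0) ∷ (- + 6704 , 1 , 2 , 0 , 0) ∷
         (- + 105920 , 1 , 3 , 0 , 0) ∷ (- + 196992 , 1 , 4 , 0 , 0) ∷ (- + 410368 , 1 , 5 , 0 , 0) ∷
         (- + 802816 , 1 , 6 , 0 , 0) ∷ (- + 830976 , 1 , 7 , 0 , 0) ∷ (- + 441344 , 1 , 8 , 0 , 0) ∷
         (- + 116736 , 1 , 9 , 0 , 0) ∷ (- + 12288 , 1 , 10 , 0 , 0) ∷ []
  ; Q  = (- + 2555 , 0 , 0 , 0 , 0) ∷ (- + 33528 , 0 , 1 , 0 , 0) ∷ (- + 50292 , 0 , 2 , 0 , 0) ∷
         (+ 99000 , 0 , 3 , 0 , 0) ∷ (+ 98208 , 0 , 4 , 0 , 0) ∷ (- + 124608 , 0 , 5 , 0 , 0) ∷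
         (- + 88704 , 0 , 6 , 0 , 0) ∷ (+ 87296 , 0 , 7 , 0 , 0) ∷ (+ 42240 , 0 , 8 , 0 , 0) ∷
         (- + 34304 , 0 , 9 , 0 , 0) ∷ (- + 9216 , 0 , 10 , 0 , 0) ∷ (+ 6144 , 0 , 11 , 0 , 0) ∷
         (- + 33528 , 1 , 1 , 0 , 0) ∷ (- + 67056 , 1 , 2 , 0 , 0) ∷ (+ 65472 , 1 , 3 , 0 , 0) ∷
         (+ 130944 , 1 , 4 , 0 , 0) ∷ (- + 59136 , 1 , 5 , 0 , 0) ∷ (- + 118272 , 1 , 6 , 0 , 0) ∷
         (+ 28160 , 1 , 7 , 0 , 0) ∷ (+ 56320 , 1 , 8 , 0 , 0) ∷ (- + 6144 , 1 , 9 , 0 , 0) ∷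
         (- + 12288 , 1 , 10 , 0 , 0) ∷ []
  ; F₃ = []
  ; F₅ = []
  }

certificate₁₃ : Certificate (+ 1365) 13
certificate₁₃ = record
  { scale = + 1
  ; P  = (- + 2824859 , 0 , 0 , 0 , 0) ∷ (- + 4141056 , 0 , 1 , 0 , 0) ∷ (+ 5418696 , 0 , 2 , 0 , 0) ∷
         (- + 23949936 , 0 , 3 , 0 , 0) ∷ (+ 14995536 , 0 , 4 , 0 , 0) ∷ (+ 208571808 , 0 , 5 , 0 , 0) ∷
         (+ 350995200 , 0 , 6 , 0 , 0) ∷ (+ 497395200 , 0 , 7 , 0 , 0) ∷ (+ 749656320 , 0 , 8 , 0 , 0) ∷
         (+ 776348160 , 0 , 9 , 0 , 0) ∷ (+ 476743680 , 0 , 10 , 0 , 0) ∷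
         (+ 169021440 , 0 , 11 , 0 , 0) ∷ (+ 32256000 , 0 , 12 , 0 , 0) ∷ (+ 2580480 , 0 , 13 , 0 , 0) ∷
         (+ 2826224 , 1 , 0 , 0 , 0) ∷ (- + 65520 , 1 , 1 , 0 , 0) ∷ (- + 3546944 , 1 , 2 , 0 , 0) ∷
         (+ 19513568 , 1 , 3 , 0 , 0) ∷ (- + 29510592 , 1 , 4 , 0 , 0) ∷
         (- + 109537280 , 1 , 5 , 0 , 0) ∷ (- + 124459520 , 1 , 6 , 0 , 0) ∷
         (- + 207137280 , 1 , 7 , 0 , 0) ∷ (- + 292633600 , 1 , 8 , 0 , 0) ∷
         (- + 224931840 , 1 , 9 , 0 , 0) ∷ (- + 92897280 , 1 , 10 , 0 , 0) ∷
         (- + 19783680 , 1 , 11 , 0 , 0) ∷ (- + 1720320 , 1 , 12 , 0 , 0) ∷ []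
  ; Q  = (+ 1414477 , 0 , 0 , 0 , 0) ∷ (+ 18600400 , 0 , 1 , 0 , 0) ∷ (+ 27900600 , 0 , 2 , 0 , 0) ∷
         (- + 55212976 , 0 , 3 , 0 , 0) ∷ (- + 54918864 , 0 , 4 , 0 , 0) ∷ (+ 70658016 , 0 , 5 , 0 , 0) ∷
         (+ 51068160 , 0 , 6 , 0 , 0) ∷ (- + 51983360 , 0 , 7 , 0 , 0) ∷ (- + 26906880 , 0 , 8 , 0 , 0) ∷
         (+ 23528960 , 0 , 9 , 0 , 0) ∷ (+ 8386560 , 0 , 10 , 0 , 0) ∷ (- + 6451200 , 0 , 11 , 0 , 0) ∷
         (- + 1290240 , 0 , 12 , 0 , 0) ∷ (+ 860160 , 0 , 13 , 0 , 0) ∷ (+ 18600400 , 1 , 1 , 0 , 0) ∷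
         (+ 37200800 , 1 , 2 , 0 , 0) ∷ (- + 36612576 , 1 , 3 , 0 , 0) ∷ (- + 73225152 , 1 , 4 , 0 , 0) ∷
         (+ 34045440 , 1 , 5 , 0 , 0) ∷ (+ 68090880 , 1 , 6 , 0 , 0) ∷ (- + 17937920 , 1 , 7 , 0 , 0) ∷
         (- + 35875840 , 1 , 8 , 0 , 0) ∷ (+ 5591040 , 1 , 9 , 0 , 0) ∷ (+ 11182080 , 1 , 10 , 0 , 0) ∷
         (- + 860160 , 1 , 11 , 0 , 0) ∷ (- + 1720320 , 1 , 12 , 0 , 0) ∷ []
  ; F₃ = []
  ; F₅ = []
  }

certificate₁₅ : Certificate (+ 3) 15
certificate₁₅ = record
  { scale = + 15
  ; P  = (+ 114683 , 0 , 0 , 0 , 0) ∷ (+ 53853600 , 0 , 0 , 0 , 1) ∷ (+ 10942992 , 0 , 1 , 0 , 0) ∷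
         (+ 75469120 , 0 , 1 , 0 , 1) ∷ (+ 14925332 , 0 , 2 , 0 , 0) ∷ (+ 101336192 , 0 , 2 , 0 , 1) ∷
         (+ 21600072 , 0 , 3 , 0 , 0) ∷ (+ 81594112 , 0 , 3 , 0 , 1) ∷ (+ 17445712 , 0 , 4 , 0 , 0) ∷
         (+ 66323968 , 0 , 4 , 0 , 1) ∷ (+ 70904832 , 0 , 5 , 0 , 1) ∷ (+ 58374144 , 0 , 6 , 0 , 1) ∷
         (+ 29503488 , 0 , 7 , 0 , 1) ∷ (+ 8773632 , 0 , 8 , 0 , 1) ∷ (+ 1425408 , 0 , 9 , 0 , 1) ∷
         (+ 98304 , 0 , 10 , 0 , 1) ∷ (- + 114680 , 1 , 0 , 0 , 0) ∷ (+ 143944320 , 1 , 0 , 0 , 1) ∷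
         (- + 325425600 , 1 , 0 , 1 , 0) ∷ (- + 79686504 , 1 , 1 , 0 , 0) ∷
         (+ 308870400 , 1 , 1 , 0 , 1) ∷ (- + 325365120 , 1 , 1 , 1 , 0) ∷
         (- + 46568464 , 1 , 2 , 0 , 0) ∷ (+ 299146752 , 1 , 2 , 0 , 1) ∷
         (- + 295394048 , 1 , 2 , 1 , 0) ∷ (+ 68838816 , 1 , 3 , 0 , 0) ∷ (+ 190417920 , 1 , 3 , 0 , 1) ∷
         (- + 332858880 , 1 , 3 , 1 , 0) ∷ (+ 35835456 , 1 , 4 , 0 , 0) ∷ (+ 207525888 , 1 , 4 , 0 , 1) ∷
         (- + 337781760 , 1 , 4 , 1 , 0) ∷ (+ 217903104 , 1 , 5 , 0 , 1) ∷
         (- + 272214016 , 1 , 5 , 1 , 0) ∷ (+ 132341760 , 1 , 6 , 0 , 1) ∷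
         (- + 226578432 , 1 , 6 , 1 , 0) ∷ (+ 44679168 , 1 , 7 , 0 , 1) ∷
         (- + 175054848 , 1 , 7 , 1 , 0) ∷ (+ 7962624 , 1 , 8 , 0 , 1) ∷ (- + 93536256 , 1 , 8 , 1 , 0) ∷
         (+ 589824 , 1 , 9 , 0 , 1) ∷ (- + 30179328 , 1 , 9 , 1 , 0) ∷ (- + 5308416 , 1 , 10 , 1 , 0) ∷
         (- + 393216 , 1 , 11 , 1 , 0) ∷ []
  ; Q  = (- + 860055 , 0 , 0 , 0 , 0) ∷ (- + 11315816 , 0 , 1 , 0 , 0) ∷ (- + 16973724 , 0 , 2 , 0 , 0) ∷
         (+ 33636296 , 0 , 3 , 0 , 0) ∷ (+ 33480720 , 0 , 4 , 0 , 0) ∷ (- + 43241952 , 0 , 5 , 0 , 0) ∷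
         (- + 31382208 , 0 , 6 , 0 , 0) ∷ (+ 32269952 , 0 , 7 , 0 , 0) ∷ (+ 17022720 , 0 , 8 , 0 , 0) ∷
         (- + 15262208 , 0 , 9 , 0 , 0) ∷ (- + 5870592 , 0 , 10 , 0 , 0) ∷ (+ 4773888 , 0 , 11 , 0 , 0) ∷
         (+ 1290240 , 0 , 12 , 0 , 0) ∷ (- + 958464 , 0 , 13 , 0 , 0) ∷ (- + 147456 , 0 , 14 , 0 , 0) ∷
         (+ 98304 , 0 , 15 , 0 , 0) ∷ (- + 11315816 , 1 , 1 , 0 , 0) ∷ (- + 22631632 , 1 , 2 , 0 , 0) ∷
         (+ 22320480 , 1 , 3 , 0 , 0) ∷ (+ 44640960 , 1 , 4 , 0 , 0) ∷ (- + 20921472 , 1 , 5 , 0 , 0) ∷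
         (- + 41842944 , 1 , 6 , 0 , 0) ∷ (+ 11348480 , 1 , 7 , 0 , 0) ∷ (+ 22696960 , 1 , 8 , 0 , 0) ∷
         (- + 3913728 , 1 , 9 , 0 , 0) ∷ (- + 7827456 , 1 , 10 , 0 , 0) ∷ (+ 860160 , 1 , 11 , 0 , 0) ∷
         (+ 1720320 , 1 , 12 , 0 , 0) ∷ (- + 98304 , 1 , 13 , 0 , 0) ∷ (- + 196608 , 1 , 14 , 0 , 0) ∷ []
  ; F₃ = (- + 146441520000 , 0 , 0 , 0 , 0) ∷ (- + 244041984000 , 0 , 1 , 0 , 0) ∷
         (- + 181723017600 , 0 , 2 , 0 , 0) ∷ (- + 189599942400 , 0 , 3 , 0 , 0) ∷
         (- + 207550348800 , 0 , 4 , 0 , 0) ∷ (- + 173902003200 , 0 , 5 , 0 , 0) ∷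
         (- + 132957235200 , 0 , 6 , 0 , 0) ∷ (- + 105916108800 , 0 , 7 , 0 , 0) ∷
         (- + 60621004800 , 0 , 8 , 0 , 0) ∷ (- + 15383347200 , 0 , 9 , 0 , 0) ∷
         (+ 2587852800 , 0 , 10 , 0 , 0) ∷ (+ 2757427200 , 0 , 11 , 0 , 0) ∷
         (+ 678297600 , 0 , 12 , 0 , 0) ∷ (+ 58982400 , 0 , 13 , 0 , 0) ∷
         (- + 439324560000 , 1 , 0 , 0 , 0) ∷ (- + 829753632000 , 1 , 1 , 0 , 0) ∷
         (- + 667185508800 , 1 , 2 , 0 , 0) ∷ (- + 633006585600 , 1 , 3 , 0 , 0) ∷
         (- + 720265416000 , 1 , 4 , 0 , 0) ∷ (- + 628098230400 , 1 , 5 , 0 , 0) ∷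
         (- + 478095264000 , 1 , 6 , 0 , 0) ∷ (- + 380435059200 , 1 , 7 , 0 , 0) ∷
         (- + 235874380800 , 1 , 8 , 0 , 0) ∷ (- + 73769318400 , 1 , 9 , 0 , 0) ∷
         (+ 959385600 , 1 , 10 , 0 , 0) ∷ (+ 5317632000 , 1 , 11 , 0 , 0) ∷
         (- + 969523200 , 1 , 12 , 0 , 0) ∷ (- + 1319731200 , 1 , 13 , 0 , 0) ∷
         (- + 339148800 , 1 , 14 , 0 , 0) ∷ (- + 29491200 , 1 , 15 , 0 , 0) ∷
         (- + 439324560000 , 2 , 0 , 0 , 0) ∷ (- + 976195152000 , 2 , 1 , 0 , 0) ∷
         (- + 935634412800 , 2 , 2 , 0 , 0) ∷ (- + 839131987200 , 2 , 3 , 0 , 0) ∷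
         (- + 907612992000 , 2 , 4 , 0 , 0) ∷ (- + 836210611200 , 2 , 5 , 0 , 0) ∷
         (- + 655176345600 , 2 , 6 , 0 , 0) ∷ (- + 508843929600 , 2 , 7 , 0 , 0) ∷
         (- + 333450240000 , 2 , 8 , 0 , 0) ∷ (- + 127103385600 , 2 , 9 , 0 , 0) ∷
         (- + 4445798400 , 2 , 10 , 0 , 0) ∷ (+ 18771148800 , 2 , 11 , 0 , 0) ∷
         (+ 8404992000 , 2 , 12 , 0 , 0) ∷ (+ 1592524800 , 2 , 13 , 0 , 0) ∷
         (+ 117964800 , 2 , 14 , 0 , 0) ∷ (- + 146441520000 , 3 , 0 , 0 , 0) ∷
         (- + 390483504000 , 3 , 1 , 0 , 0) ∷ (- + 474578841600 , 3 , 2 , 0 , 0) ∷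
         (- + 468941568000 , 3 , 3 , 0 , 0) ∷ (- + 490264166400 , 3 , 4 , 0 , 0) ∷
         (- + 475690291200 , 3 , 5 , 0 , 0) ∷ (- + 407455334400 , 3 , 6 , 0 , 0) ∷
         (- + 330372710400 , 3 , 7 , 0 , 0) ∷ (- + 241355980800 , 3 , 8 , 0 , 0) ∷
         (- + 136249344000 , 3 , 9 , 0 , 0) ∷ (- + 53084160000 , 3 , 10 , 0 , 0) ∷
         (- + 13212057600 , 3 , 11 , 0 , 0) ∷ (- + 1887436800 , 3 , 12 , 0 , 0) ∷
         (- + 117964800 , 3 , 13 , 0 , 0) ∷ []
  ; F₅ = (+ 43711790400 , 0 , 0 , 0 , 0) ∷ (+ 125790854400 , 0 , 1 , 0 , 0) ∷
         (+ 143692593120 , 0 , 2 , 0 , 0) ∷ (+ 94801968000 , 0 , 3 , 0 , 0) ∷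
         (+ 75111167520 , 0 , 4 , 0 , 0) ∷ (+ 87974752320 , 0 , 5 , 0 , 0) ∷
         (+ 68526126720 , 0 , 6 , 0 , 0) ∷ (+ 23948133120 , 0 , 7 , 0 , 0) ∷
         (- + 1642037760 , 0 , 8 , 0 , 0) ∷ (- + 4111672320 , 0 , 9 , 0 , 0) ∷
         (- + 768337920 , 0 , 10 , 0 , 0) ∷ (+ 438497280 , 0 , 11 , 0 , 0) ∷
         (+ 262103040 , 0 , 12 , 0 , 0) ∷ (+ 55296000 , 0 , 13 , 0 , 0) ∷ (+ 4423680 , 0 , 14 , 0 , 0) ∷
         (+ 126288547200 , 1 , 0 , 0 , 0) ∷ (+ 391643496000 , 1 , 1 , 0 , 0) ∷
         (+ 489356527680 , 1 , 2 , 0 , 0) ∷ (+ 344560147200 , 1 , 3 , 0 , 0) ∷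
         (+ 260759491200 , 1 , 4 , 0 , 0) ∷ (+ 301763692800 , 1 , 5 , 0 , 0) ∷
         (+ 247414464000 , 1 , 6 , 0 , 0) ∷ (+ 98361584640 , 1 , 7 , 0 , 0) ∷
         (+ 5915842560 , 1 , 8 , 0 , 0) ∷ (- + 9594408960 , 1 , 9 , 0 , 0) ∷
         (- + 3294535680 , 1 , 10 , 0 , 0) ∷ (- + 245514240 , 1 , 11 , 0 , 0) ∷
         (+ 57507840 , 1 , 12 , 0 , 0) ∷ (+ 8847360 , 1 , 13 , 0 , 0) ∷
         (+ 121441723200 , 2 , 0 , 0 , 0) ∷ (+ 414022593600 , 2 , 1 , 0 , 0) ∷
         (+ 587281132800 , 2 , 2 , 0 , 0) ∷ (+ 472772505600 , 2 , 3 , 0 , 0) ∷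
         (+ 347253120000 , 2 , 4 , 0 , 0) ∷ (+ 367081574400 , 2 , 5 , 0 , 0) ∷
         (+ 324981964800 , 2 , 6 , 0 , 0) ∷ (+ 161033011200 , 2 , 7 , 0 , 0) ∷
         (+ 30722457600 , 2 , 8 , 0 , 0) ∷ (- + 7652966400 , 2 , 9 , 0 , 0) ∷
         (- + 5485363200 , 2 , 10 , 0 , 0) ∷ (- + 1150156800 , 2 , 11 , 0 , 0) ∷
         (- + 88473600 , 2 , 12 , 0 , 0) ∷ (+ 38864966400 , 3 , 0 , 0 , 0) ∷
         (+ 148169952000 , 3 , 1 , 0 , 0) ∷ (+ 245671280640 , 3 , 2 , 0 , 0) ∷
         (+ 241625548800 , 3 , 3 , 0 , 0) ∷ (+ 195566469120 , 3 , 4 , 0 , 0) ∷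
         (+ 186495713280 , 3 , 5 , 0 , 0) ∷ (+ 171143331840 , 3 , 6 , 0 , 0) ∷
         (+ 110839726080 , 3 , 7 , 0 , 0) ∷ (+ 46077050880 , 3 , 8 , 0 , 0) ∷
         (+ 11784683520 , 3 , 9 , 0 , 0) ∷ (+ 1698693120 , 3 , 10 , 0 , 0) ∷
         (+ 106168320 , 3 , 11 , 0 , 0) ∷ []
  }

corollary5p1 : (r : ℕ) → 2 ≤ r → r ≤ 8 → (n : ℕ) → .{{_ : NonZero n}} →
                   n ^ 2 ∣ a (2 * r ∸ 1) * sumBelow n (S (2 * r ∸ 1))
corollary5p1 0 () _ _
corollary5p1 1 (s≤s ()) _ _
corollary5p1 2 _ _ n = Checked.n²∣a*∑S certificate₃  (λ _ → refl) refl n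
corollary5p1 3 _ _ n = Checked.n²∣a*∑S certificate₅  (λ _ → refl) refl n
corollary5p1 4 _ _ n = Checked.n²∣a*∑S certificate₇  (λ _ → refl) refl n
corollary5p1 5 _ _ n = Checked.n²∣a*∑S certificate₉  (λ _ → refl) refl n
corollary5p1 6 _ _ n = Checked.n²∣a*∑S certificate₁₁ (λ _ → refl) refl n
corollary5p1 7 _ _ n = Checked.n²∣a*∑S certificate₁₃ (λ _ → refl) refl n
corollary5p1 8 _ _ n = Checked.n²∣a*∑S certificate₁₅ (λ _ → refl) refl n
corollary5p1 (suc (suc (suc (suc (suc (suc (suc (suc (suc _))))))))) _ (s≤s (s≤s (s≤s (s≤s (s≤s (s≤s (s≤s (s≤s ())))))))) _
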